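{- Let $G$ be a graph with a set of terminals $R$, where $|R|\ge 3$ and every pair of adjacent terminals is joined by exactly two (parallel) edges in $G$. Let $G_s$ be a simple graph underlying $G$. If $\{T_1,\dots,T_k\}$ is an $R$-IDST of $G_s$, then there exist trees $T_1',\dots,T_k'$ of $G$ with $T_i$ and $T_i'$ being $R$-parallel for every $i\in[k]$, such that $\{T_1',\dots,T_k'\}$ is an $R$-CIST of $G$. Conversely, if $\{T_1',\dots,T_k'\}$ is an $R$-CIST of $G$ and $T_1,\dots,T_k$ are trees of $G_s$ with $T_i$ and $T_i'$ $R$-parallel for every $i$, then $\{T_1,\dots,T_k\}$ is an $R$-IDST of $G_s$.
   Context: Graphs are finite and connected, may have parallel edges but no loops; a simple graph underlying $G$ is obtained by keeping exactly one edge from each class of parallel edges. For a tree $T$, $\mathrm{int}(T)$ is the set of vertices of degree at least 2 in $T$ and $L(T)$ the set of leaves. An $R$-Steiner tree is a subtree $T$ with $R\subseteq V(T)$ and $L(T)\subseteq R$; $T(u,v)$ is the unique $(u,v)$-path in $T$. An $R$-CIST is a set $\{T_1,\dots,T_k\}$ of $R$-Steiner trees such that for all distinct $u,v\in R$ and distinct $i,j$, $T_i(u,v)$ and $T_j(u,v)$ are edge-disjoint and internally vertex-disjoint. An $R$-IDST of a simple graph is a set $\{T_1,\dots,T_k\}$ of $R$-Steiner trees with $\mathrm{int}(T_i)\cap\mathrm{int}(T_j)=\emptyset$ for all distinct $i,j$. Two trees $T_1,T_2$ of $G$ are $R$-parallel if for every edge $e$ of $G$: if $e$ is not an edge of $G[R]$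 then $e\in E(T_1)$ iff $e\in E(T_2)$; if $e\in E(G[R])$ then $e\in E(T_1)$ iff $E(T_2)$ contains $e$ or an edge parallel to $e$. -}

module Defs where

open import Data.Nat using (ℕ; _≤_)
open import Data.Fin using (Fin; _≟_)
open import Data.Fin.Subset using (Subset; _∈_; _∩_; ∣_∣; _⊆_) public
open import Data.Vec using (tabulate)
open import Data.Bool using (Bool)
open import Data.Product using (Σ; ∃; _×_; _,_; proj₁; proj₂)
open import Data.Product.Properties using (≡-dec)
open import Data.Sum using (_⊎_)
open import Data.Empty using (⊥)
open import Data.List using (List; []; _∷_)
open import Data.List.Relation.Unary.All using (All)
open import Data.List.Relation.Unary.Unique.Propositional using (Unique)
import Data.List.Membership.Propositional as LM
open import Relation.Nullary using (¬_; Dec; does)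
open import Relation.Nullary.Decidable using (_⊎-dec_)
open import Relation.Binary.PropositionalEquality using (_≡_; _≢_)
open import Function.Bundles using (_⇔_)

_∈ˡ_ : {A : Set} → A → List A → Set
x ∈ˡ xs = x LM.∈ xs

record Graph (n m : ℕ) : Set where
  field
    ends : Fin m → Fin n × Fin n
    noLoop : ∀ e → proj₁ (ends e) ≢ proj₂ (ends e)

module _ {n m : ℕ} (G : Graph n m) where
  open Graph G

  Joins : Fin m → Fin n → Fin n → Set
  Joins e u w = (ends e ≡ (u , w)) ⊎ (ends e ≡ (w , u))

  joins? : ∀ e u w → Dec (Joins e u w)
  joins? e u w = ≡-dec _≟_ _≟_ (ends e) (u , w) ⊎-dec ≡-dec _≟_ _≟_ (ends e) (w , u)

  mult : Fin n → Fin n → ℕ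
  mult u w = ∣ tabulate (λ e → does (joins? e u w)) ∣

  ParallelOrEq : Fin m → Fin m → Set
  ParallelOrEq e f = Joins f (proj₁ (ends e)) (proj₂ (ends e))

  data Walk : Fin n → Fin n → Set where
    [] : ∀ {u} → Walk u u
    step : ∀ {u w v} (e : Fin m) → Joins e u w → Walk w v → Walk u v

  wVerts : ∀ {u v} → Walk u v → List (Fin n)
  wVerts {u} [] = u ∷ []
  wVerts {u} (step e _ p) = u ∷ wVerts p

  wEdges : ∀ {u v} → Walk u v → List (Fin m)
  wEdges [] = []
  wEdges (step e _ p) = e ∷ wEdges p

  IsPath : ∀ {u v} → Walk u v → Set
  IsPath p = Unique (wVerts p)

  Connected : Set
  Connected = ∀ u v → Walk u v

  record Subgraph : Set where
    field
      verts : Subset n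
      edges : Subset m
  open Subgraph public

  InSub : Subgraph → ∀ {u v} → Walk u v → Set
  InSub T p = All (λ e → e ∈ edges T) (wEdges p)

  PathIn : Subgraph → Fin n → Fin n → Set
  PathIn T u v = Σ (Walk u v) (λ p → InSub T p × IsPath p)

  IsTree : Subgraph → Set
  IsTree T =
    (∀ e u w → e ∈ edges T → Joins e u w → u ∈ verts T × w ∈ verts T)
    × (∃ λ v → v ∈ verts T)
    × (∀ u v → u ∈ verts T → v ∈ verts T → Σ (Walk u v) (InSub T))
    × (∀ e u w → e ∈ edges T → Joins e u w →
         ¬ (Σ (PathIn T w u) (λ P → All (λ f → f ≢ e) (wEdges (proj₁ P)))))

  incid : Fin n → Subset m
  incid v = tabulate (λ e → does (joins? e v (proj₁ (ends e)) ⊎-dec joins? e v (proj₂ (ends e))))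

  deg : Subgraph → Fin n → ℕ
  deg T v = ∣ edges T ∩ incid v ∣

  Interior : Subgraph → Fin n → Set
  Interior T v = 2 ≤ deg T v

  IsSteinerTree : Subset n → Subgraph → Set
  IsSteinerTree R T = IsTree T × R ⊆ verts T × (∀ v → v ∈ verts T → deg T v ≡ 1 → v ∈ R)

  IsCIST : Subset n → (k : ℕ) → (Fin k → Subgraph) → Set
  IsCIST R k T =
    (∀ i → IsSteinerTree R (T i))
    × (∀ u v → u ∈ R → v ∈ R → u ≢ v → ∀ i j → i ≢ j →
         (P : PathIn (T i) u v) (Q : PathIn (T j) u v) →
           (∀ e → e ∈ˡ wEdges (proj₁ P) → e ∈ˡ wEdges (proj₁ Q) → ⊥)
           × (∀ x → x ∈ˡ wVerts (proj₁ P) → x ∈ˡ wVerts (proj₁ Q) → x ≡ u ⊎ x ≡ v))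

  -- S ⊆ E(G) is the edge set of a simple graph underlying G:
  -- exactly one edge kept from each parallel class
  IsUnderlyingSimple : Subset m → Set
  IsUnderlyingSimple S =
    (∀ e → ∃ λ f → f ∈ S × ParallelOrEq e f)
    × (∀ f f' → f ∈ S → f' ∈ S → ParallelOrEq f f' → f ≡ f')

  -- T is a tree of the simple graph G_s (spanning subgraph of G with edge set S)
  IsTreeOfSimple : Subset m → Subgraph → Set
  IsTreeOfSimple S T = IsTree T × edges T ⊆ S

  IsIDST : Subset m → Subset n → (k : ℕ) → (Fin k → Subgraph) → Set
  IsIDST S R k T =
    (∀ i → IsSteinerTree R (T i) × edges (T i) ⊆ S)
    × (∀ i j → i ≢ j → ∀ v → ¬ (Interior (T i) v × Interior (T j) v))

  EdgeOfGR : Subset n → Fin m → Set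
  EdgeOfGR R e = proj₁ (ends e) ∈ R × proj₂ (ends e) ∈ R

  -- T₁ and T₂ are R-parallel (symmetric reading)
  RParallel : Subset n → Subgraph → Subgraph → Set
  RParallel R T₁ T₂ = ∀ e →
    (¬ EdgeOfGR R e → (e ∈ edges T₁ ⇔ e ∈ edges T₂))
    × (EdgeOfGR R e →
         ((∃ λ f → f ∈ edges T₁ × ParallelOrEq e f) ⇔ (∃ λ f → f ∈ edges T₂ × ParallelOrEq e f)))

  TerminalsDoubled : Subset n → Set
  TerminalsDoubled R = ∀ u v → u ∈ R → v ∈ R → (e : Fin m) → Joins e u v → mult u v ≡ 2

-- An R-IDST {Tᵢ} of Gₛ becomes an R-CIST of G by keeping the edges of Tᵢ outside G[R] and
-- replacing each terminal edge uv of Tᵢ by one of its two copies: the copy in Gₛ if u is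
-- interior in Tᵢ, the other one if not. R-parallel trees have the same interior vertices, so
-- the internal vertices of Tᵢ′(x,y) and Tⱼ′(x,y) are interior in Tᵢ and in Tⱼ, hence distinct;
-- a copy shared by Tᵢ′ and Tⱼ′ would make u, or else v (there is a third terminal), interior
-- in both trees.
-- Conversely, if v is interior in Tᵢ′ and Tⱼ′ then, all leaves being terminals, every branch
-- at v reaches a terminal, so each tree splits the terminals other than v into at least two
-- sectors. Two such partitions separate a common pair x, y, and then Tᵢ′(x,y) and Tⱼ′(x,y)
-- both pass through v.

module Submission where

open import Defs
open import Data.Nat using (ℕ; zero; suc; _+_; _≤_; _<_; z≤n; s≤s; _≤?_)
open import Data.Nat.Properties
  using (≤-refl; ≤-trans; ≤-pred; n≤1+n; ≤-antisym; ≰⇒>; <⇒≱; +-identityʳ; +-suc)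
open import Data.Fin using (Fin; zero; suc; _≟_)
open import Data.Fin.Properties using (suc-injective)
open import Data.Fin.Subset using (Subset; _∉_; _-_; Nonempty; inside; outside; ⊤)
open import Data.Fin.Subset.Properties
  using (x∈p∩q⁺; x∈p∩q⁻; ∈⊤; ∣⊤∣≡n; x∈p∧x≢y⇒x∈p-y; x∈p⇒∣p-x∣<∣p∣)
  renaming (_∈?_ to _∈ₛ?_)
open import Data.Vec using (_∷_; here; there; tabulate; _[_]≔_)
open import Data.Vec.Properties using (lookup∘tabulate; []=⇒lookup; lookup⇒[]=)
open import Data.List using (List; []; _∷_; length; _++_; reverse; _∷ʳ_)
open import Data.List.Properties using (unfold-reverse)
open import Data.List.Relation.Unary.All using (All; []; _∷_)
import Data.List.Relation.Unary.All as All
open import Data.List.Relation.Unary.All.Properties using (anti-mono; ¬Any⇒All¬)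
open import Data.List.Relation.Unary.Any using (here; there)
import Data.List.Relation.Unary.Any.Properties as Any
open import Data.List.Relation.Unary.AllPairs using ([]; _∷_; head)
open import Data.List.Relation.Unary.Unique.Propositional using (Unique)
open import Data.List.Membership.Propositional.Properties using (∈-++⁻)
open import Data.List.Relation.Binary.Subset.Propositional renaming (_⊆_ to _⊆ˡ_)
open import Data.List.Relation.Binary.Subset.Propositional.Properties
  using (⊆-refl; ⊆-trans; xs⊆x∷xs; ∷⁺ʳ)
open import Data.List.Relation.Binary.Permutation.Setoid using (↭-sym)
open import Data.List.Relation.Binary.Permutation.Setoid.Properties using (Unique-resp-↭; ↭-reverse)
open import Data.Product using (Σ; ∃; ∃₂; _×_; _,_; proj₁; proj₂)
open import Data.Product.Properties using (,-injective)
open import Data.Sum using (_⊎_; inj₁; inj₂; [_,_])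
open import Data.Empty using (⊥; ⊥-elim)
open import Function using (_∘_)
open import Function.Bundles using (mk⇔; Equivalence)
open import Function.Properties.Equivalence using () renaming (sym to ⇔-sym)
open import Relation.Nullary using (¬_; Dec; yes; no; does; ¬?)
open import Relation.Nullary.Decidable using (dec-true; _×-dec_; _⊎-dec_)
open import Relation.Unary using (Decidable)
open import Relation.Binary.Definitions using (DecidableEquality)
open import Relation.Binary.PropositionalEquality
  using (_≡_; _≢_; refl; sym; trans; cong; subst; setoid; module ≡-Reasoning)

-- Finite sets

module _ {n : ℕ} {P : Fin n → Set} (P? : Decidable P) where

  ∈-select⁺ : ∀ {x} → P x → x ∈ tabulate (does ∘ P?)
  ∈-select⁺ {x} px = lookup⇒[]= x _ (trans (lookup∘tabulate (does ∘ P?) x) (dec-true (P? x) px))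

  ∈-select⁻ : ∀ {x} → x ∈ tabulate (does ∘ P?) → P x
  ∈-select⁻ {x} x∈ with P? x | trans (sym (lookup∘tabulate (does ∘ P?) x)) ([]=⇒lookup x∈)
  ... | yes px | _ = px

-- Unlike Data.Fin.Subset._-_, which is defined by zipWith, this computes on open subsets.
_∖_ : ∀ {n} → Subset n → Fin n → Subset n
p ∖ x = p [ x ]≔ outside

∣p∣≤1+∣p∖x∣ : ∀ {n} (p : Subset n) (x : Fin n) → ∣ p ∣ ≤ suc ∣ p ∖ x ∣
∣p∣≤1+∣p∖x∣ (inside  ∷ p) zero    = ≤-refl
∣p∣≤1+∣p∖x∣ (outside ∷ p) zero    = n≤1+n ∣ p ∣
∣p∣≤1+∣p∖x∣ (inside  ∷ p) (suc x) = s≤s (∣p∣≤1+∣p∖x∣ p x)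
∣p∣≤1+∣p∖x∣ (outside ∷ p) (suc x) = ∣p∣≤1+∣p∖x∣ p x

∈-∖⁻ : ∀ {n} {p : Subset n} {x y : Fin n} → y ∈ p ∖ x → y ∈ p × y ≢ x
∈-∖⁻ {p = _ ∷ _} {x = zero}  (there y∈) = there y∈ , λ ()
∈-∖⁻ {p = _ ∷ _} {x = suc _} here       = here , λ ()
∈-∖⁻ {p = _ ∷ _} {x = suc _} (there y∈) with ∈-∖⁻ y∈
... | y∈p , y≢x = there y∈p , y≢x ∘ suc-injective

∣p∣>0⇒Nonempty : ∀ {n} (p : Subset n) → 0 < ∣ p ∣ → Nonempty p
∣p∣>0⇒Nonempty (inside  ∷ p) _   = zero , here
∣p∣>0⇒Nonempty (outside ∷ p) ∣p∣>0 with ∣p∣>0⇒Nonempty p ∣p∣>0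
... | x , x∈p = suc x , there x∈p

∃-∈-avoiding : ∀ {n} (p : Subset n) (xs : List (Fin n)) → length xs < ∣ p ∣ →
  ∃ λ x → x ∈ p × All (x ≢_) xs
∃-∈-avoiding p []       ∣p∣>0 with ∣p∣>0⇒Nonempty p ∣p∣>0
... | x , x∈p = x , x∈p , []
∃-∈-avoiding p (y ∷ ys) len<
  with ∃-∈-avoiding (p ∖ y) ys (≤-pred (≤-trans len< (∣p∣≤1+∣p∖x∣ p y)))
... | x , x∈p-y , x∉ys = x , proj₁ (∈-∖⁻ x∈p-y) , proj₂ (∈-∖⁻ x∈p-y) ∷ x∉ys

length≤∣p∣ : ∀ {n} {p : Subset n} (xs : List (Fin n)) → Unique xs → All (_∈ p) xs → length xs ≤ ∣ p ∣
length≤∣p∣ []       _            _           = z≤n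
length≤∣p∣ {p = p} (x ∷ xs) (x∉xs ∷ u) (x∈p ∷ xs⊆p) =
  ≤-trans (s≤s (length≤∣p∣ {p = p - x} xs u (All.zipWith within (x∉xs , xs⊆p))))
          (x∈p⇒∣p-x∣<∣p∣ x∈p)
  where
  within : ∀ {y} → x ≢ y × y ∈ p → y ∈ p - x
  within (x≢y , y∈p) = x∈p∧x≢y⇒x∈p-y y∈p (x≢y ∘ sym)

∃-other-value : ∀ {K C : Set} → DecidableEquality C → (g : K → C) → ∀ {l₁ l₂} → g l₁ ≢ g l₂ →
  ∀ k → ∃ λ s → g s ≢ g k
∃-other-value _≟C_ g {l₁} {l₂} gl₁≢gl₂ k with g l₁ ≟C g k
... | no  gl₁≢gk = l₁ , gl₁≢gk
... | yes gl₁≡gk = l₂ , λ gl₂≡gk → gl₁≢gl₂ (trans gl₁≡gk (sym gl₂≡gk))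

common-split : ∀ {K B C : Set} → DecidableEquality B → DecidableEquality C →
  (f : K → B) (g : K → C) → (∃₂ λ k₁ k₂ → f k₁ ≢ f k₂) → (∃₂ λ l₁ l₂ → g l₁ ≢ g l₂) →
  ∃₂ λ x y → f x ≢ f y × g x ≢ g y
common-split _≟B_ _≟C_ f g (k₁ , k₂ , fk₁≢fk₂) (_ , _ , gl₁≢gl₂) with g k₁ ≟C g k₂
... | no  gk₁≢gk₂ = k₁ , k₂ , fk₁≢fk₂ , gk₁≢gk₂
... | yes gk₁≡gk₂ with ∃-other-value _≟C_ g gl₁≢gl₂ k₁
...   | s , gs≢gk₁ with f s ≟B f k₁
...     | no  fs≢fk₁ = s , k₁ , fs≢fk₁ , gs≢gk₁
...     | yes fs≡fk₁ =
  s , k₂ , fk₁≢fk₂ ∘ trans (sym fs≡fk₁) , λ gs≡gk₂ → gs≢gk₁ (trans gs≡gk₂ (sym gk₁≡gk₂))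

module _ {n m : ℕ} (G : Graph n m) where
  open Graph G
  open import Data.List.Membership.DecPropositional (_≟_ {n}) using (_∈?_)

  -- Edges and degrees

  end₁ end₂ : Fin m → Fin n
  end₁ e = proj₁ (ends e)
  end₂ e = proj₂ (ends e)

  infix 4 _∥_
  _∥_ : Fin m → Fin m → Set
  _∥_ = ParallelOrEq G

  Joins-ends : ∀ e → Joins G e (end₁ e) (end₂ e)
  Joins-ends e = inj₁ refl

  Joins-sym : ∀ {e u w} → Joins G e u w → Joins G e w u
  Joins-sym (inj₁ p) = inj₂ p
  Joins-sym (inj₂ p) = inj₁ p

  Joins-unique : ∀ {e a b c d} → Joins G e a b → Joins G e c d → (a ≡ c × b ≡ d) ⊎ (a ≡ d × b ≡ c)
  Joins-unique (inj₁ p) (inj₁ q) = inj₁ (,-injective (trans (sym p) q))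
  Joins-unique (inj₁ p) (inj₂ q) = inj₂ (,-injective (trans (sym p) q))
  Joins-unique (inj₂ p) (inj₁ q) with ,-injective (trans (sym p) q)
  ... | b≡c , a≡d = inj₂ (a≡d , b≡c)
  Joins-unique (inj₂ p) (inj₂ q) with ,-injective (trans (sym p) q)
  ... | b≡d , a≡c = inj₁ (a≡c , b≡d)

  Joins⇒≢ : ∀ {e u w} → Joins G e u w → u ≢ w
  Joins⇒≢ {e} (inj₁ p) refl = noLoop e (trans (cong proj₁ p) (sym (cong proj₂ p)))
  Joins⇒≢ {e} (inj₂ p) refl = noLoop e (trans (cong proj₁ p) (sym (cong proj₂ p)))

  Joins-same-ends : ∀ {e f a b c d} → Joins G e a b → Joins G e c d → Joins G f c d → Joins G f a b
  Joins-same-ends jab jcd f-cd with Joins-unique jab jcd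
  ... | inj₁ (refl , refl) = f-cd
  ... | inj₂ (refl , refl) = Joins-sym f-cd

  ∥-Joins : ∀ {e f u w} → e ∥ f → Joins G e u w → Joins G f u w
  ∥-Joins {e} e∥f j = Joins-same-ends j (Joins-ends e) e∥f

  Joins⇒∥ : ∀ {e f u w} → Joins G e u w → Joins G f u w → e ∥ f
  Joins⇒∥ {e} je jf = Joins-same-ends (Joins-ends e) je jf

  ∥-refl : ∀ e → e ∥ e
  ∥-refl = Joins-ends

  ∥-sym : ∀ {e f} → e ∥ f → f ∥ e
  ∥-sym {e} e∥f = Joins⇒∥ e∥f (Joins-ends e)

  ∥-trans : ∀ {e f g} → e ∥ f → f ∥ g → e ∥ g
  ∥-trans e∥f f∥g = ∥-Joins f∥g e∥f

  incident? : ∀ u f → Dec (Joins G f u (end₁ f) ⊎ Joins G f u (end₂ f))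
  incident? u f = joins? G f u (end₁ f) ⊎-dec joins? G f u (end₂ f)

  Joins⇒∈incid : ∀ {e u w} → Joins G e u w → e ∈ incid G u
  Joins⇒∈incid {e} {u} j = ∈-select⁺ (incident? u) (other-end (Joins-unique j (Joins-ends e)))
    where
    other-end : ∀ {w} → (u ≡ end₁ e × w ≡ end₂ e) ⊎ (u ≡ end₂ e × w ≡ end₁ e) →
      Joins G e u (end₁ e) ⊎ Joins G e u (end₂ e)
    other-end (inj₁ (refl , _)) = inj₂ (Joins-ends e)
    other-end (inj₂ (refl , _)) = inj₁ (Joins-sym (Joins-ends e))

  ∈incid⇒Joins : ∀ {e u} → e ∈ incid G u → ∃ (Joins G e u)
  ∈incid⇒Joins {u = u} e∈ with ∈-select⁻ (incident? u) e∈
  ... | inj₁ j = _ , j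
  ... | inj₂ j = _ , j

  data TwoEdgesAt (P : Fin m → Set) (x : Fin n) : Set where
    twoEdges : ∀ {e f y z} → e ≢ f → P e → P f → Joins G e x y → Joins G f x z → TwoEdgesAt P x

  TwoEdgesAt-map : ∀ {P Q : Fin m → Set} {x} → (∀ {e} → P e → Q e) → TwoEdgesAt P x → TwoEdgesAt Q x
  TwoEdgesAt-map P⇒Q (twoEdges e≢f pe pf je jf) = twoEdges e≢f (P⇒Q pe) (P⇒Q pf) je jf

  module _ {T : Subgraph G} where

    edge⇒0<deg : ∀ {e x y} → e ∈ edges T → Joins G e x y → 0 < deg G T x
    edge⇒0<deg e∈T j = length≤∣p∣ (_ ∷ []) ([] ∷ []) (x∈p∩q⁺ (e∈T , Joins⇒∈incid j) ∷ [])

    0<deg⇒edge : ∀ {x} → 0 < deg G T x → ∃₂ λ e y → e ∈ edges T × Joins G e x y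
    0<deg⇒edge {x} 0<d with ∃-∈-avoiding (edges T ∩ incid G x) [] 0<d
    ... | e , e∈ , _ with x∈p∩q⁻ (edges T) (incid G x) e∈
    ... | e∈T , e∈incid = e , proj₁ (∈incid⇒Joins e∈incid) , e∈T , proj₂ (∈incid⇒Joins e∈incid)

    deg≡1⊎Interior : ∀ {e x y} → e ∈ edges T → Joins G e x y → deg G T x ≡ 1 ⊎ Interior G T x
    deg≡1⊎Interior {x = x} e∈T j with 2 ≤? deg G T x
    ... | yes 2≤deg = inj₂ 2≤deg
    ... | no  2≰deg = inj₁ (≤-antisym (≤-pred (≰⇒> 2≰deg)) (edge⇒0<deg e∈T j))

    TwoEdgesAt⇒Interior : ∀ {x} → TwoEdgesAt (_∈ edges T) x → Interior G T x
    TwoEdgesAt⇒Interior (twoEdges e≢f e∈T f∈T je jf) =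
      length≤∣p∣ (_ ∷ _ ∷ []) ((e≢f ∷ []) ∷ [] ∷ [])
        (x∈p∩q⁺ (e∈T , Joins⇒∈incid je) ∷ x∈p∩q⁺ (f∈T , Joins⇒∈incid jf) ∷ [])

    Interior⇒TwoEdgesAt : ∀ {x} → Interior G T x → TwoEdgesAt (_∈ edges T) x
    Interior⇒TwoEdgesAt {x} 2≤d with ∃-∈-avoiding (edges T ∩ incid G x) [] (≤-trans (s≤s z≤n) 2≤d)
    ... | e , e∈ , _ with ∃-∈-avoiding (edges T ∩ incid G x) (e ∷ []) 2≤d
    ... | f , f∈ , f≢e ∷ [] with x∈p∩q⁻ (edges T) (incid G x) e∈ | x∈p∩q⁻ (edges T) (incid G x) f∈
    ... | e∈T , e∈x | f∈T , f∈x =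
      twoEdges (f≢e ∘ sym) e∈T f∈T (proj₂ (∈incid⇒Joins e∈x)) (proj₂ (∈incid⇒Joins f∈x))

  -- Walks and paths

  infixr 5 _++ʷ_
  _++ʷ_ : ∀ {u v w} → Walk G u v → Walk G v w → Walk G u w
  []           ++ʷ q = q
  step e j p   ++ʷ q = step e j (p ++ʷ q)

  reverseʷ : ∀ {u v} → Walk G u v → Walk G v u
  reverseʷ []           = []
  reverseʷ (step e j p) = reverseʷ p ++ʷ step e (Joins-sym j) []

  start∈wVerts : ∀ {u v} (p : Walk G u v) → u ∈ˡ wVerts G p
  start∈wVerts []           = here refl
  start∈wVerts (step _ _ _) = here refl

  end∈wVerts : ∀ {u v} (p : Walk G u v) → v ∈ˡ wVerts G p
  end∈wVerts []           = here refl
  end∈wVerts (step _ _ p) = there (end∈wVerts p)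

  Joins⇒∈wVerts : ∀ {u v e a b} (p : Walk G u v) → e ∈ˡ wEdges G p → Joins G e a b →
    a ∈ˡ wVerts G p × b ∈ˡ wVerts G p
  Joins⇒∈wVerts (step e j p) (here refl) jab with Joins-unique jab j
  ... | inj₁ (refl , refl) = here refl , there (start∈wVerts p)
  ... | inj₂ (refl , refl) = there (start∈wVerts p) , here refl
  Joins⇒∈wVerts (step e j p) (there e∈) jab with Joins⇒∈wVerts p e∈ jab
  ... | a∈ , b∈ = there a∈ , there b∈

  wEdges-++ : ∀ {u v w} (p : Walk G u v) (q : Walk G v w) → wEdges G (p ++ʷ q) ≡ wEdges G p ++ wEdges G q
  wEdges-++ []           q = refl
  wEdges-++ (step e j p) q = cong (e ∷_) (wEdges-++ p q)

  wEdges-++⁻ : ∀ {u v w g} (p : Walk G u v) (q : Walk G v w) → g ∈ˡ wEdges G (p ++ʷ q) →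
    g ∈ˡ wEdges G p ⊎ g ∈ˡ wEdges G q
  wEdges-++⁻ p q g∈ = ∈-++⁻ (wEdges G p) (subst (_ ∈ˡ_) (wEdges-++ p q) g∈)

  wVerts-++⁻ : ∀ {u v w x} (p : Walk G u v) (q : Walk G v w) → x ∈ˡ wVerts G (p ++ʷ q) →
    x ∈ˡ wVerts G p ⊎ x ∈ˡ wVerts G q
  wVerts-++⁻ []           q x∈         = inj₂ x∈
  wVerts-++⁻ (step e j p) q (here refl) = inj₁ (here refl)
  wVerts-++⁻ (step e j p) q (there x∈) with wVerts-++⁻ p q x∈
  ... | inj₁ x∈p = inj₁ (there x∈p)
  ... | inj₂ x∈q = inj₂ x∈q

  wVerts-++⁺ʳ : ∀ {u v w} (p : Walk G u v) (q : Walk G v w) → wVerts G q ⊆ˡ wVerts G (p ++ʷ q)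
  wVerts-++⁺ʳ []           q = λ x∈ → x∈
  wVerts-++⁺ʳ (step e j p) q = there ∘ wVerts-++⁺ʳ p q

  wVerts-∷ʳ : ∀ {u v w e} (p : Walk G u v) (j : Joins G e v w) → wVerts G (p ++ʷ step e j []) ≡ wVerts G p ∷ʳ w
  wVerts-∷ʳ []           j = refl
  wVerts-∷ʳ (step f k p) j = cong (_ ∷_) (wVerts-∷ʳ p j)

  reverseʷ-∷ʳ : ∀ {u v w e} (p : Walk G u v) (j : Joins G e v w) →
    reverseʷ (p ++ʷ step e j []) ≡ step e (Joins-sym j) (reverseʷ p)
  reverseʷ-∷ʳ []           j = refl
  reverseʷ-∷ʳ (step f k p) j = cong (_++ʷ step f (Joins-sym k) []) (reverseʷ-∷ʳ p j)

  wVerts-reverse : ∀ {u v} (p : Walk G u v) → wVerts G (reverseʷ p) ≡ reverse (wVerts G p)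
  wVerts-reverse []               = refl
  wVerts-reverse {u} (step e j p) = begin
    wVerts G (reverseʷ p ++ʷ step e (Joins-sym j) [])  ≡⟨ wVerts-∷ʳ (reverseʷ p) (Joins-sym j) ⟩
    wVerts G (reverseʷ p) ∷ʳ u                         ≡⟨ cong (_∷ʳ u) (wVerts-reverse p) ⟩
    reverse (wVerts G p) ∷ʳ u                          ≡⟨ sym (unfold-reverse u (wVerts G p)) ⟩
    reverse (u ∷ wVerts G p)                           ∎
    where open ≡-Reasoning

  wEdges-reverse : ∀ {u v} (p : Walk G u v) → wEdges G (reverseʷ p) ≡ reverse (wEdges G p)
  wEdges-reverse []           = refl
  wEdges-reverse (step e j p) = begin
    wEdges G (reverseʷ p ++ʷ step e (Joins-sym j) [])  ≡⟨ wEdges-++ (reverseʷ p) _ ⟩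
    wEdges G (reverseʷ p) ∷ʳ e                         ≡⟨ cong (_∷ʳ e) (wEdges-reverse p) ⟩
    reverse (wEdges G p) ∷ʳ e                          ≡⟨ sym (unfold-reverse e (wEdges G p)) ⟩
    reverse (e ∷ wEdges G p)                           ∎
    where open ≡-Reasoning

  wVerts-reverse⊆ : ∀ {u v} (p : Walk G u v) → wVerts G (reverseʷ p) ⊆ˡ wVerts G p
  wVerts-reverse⊆ p x∈ = Any.reverse⁻ (subst (_ ∈ˡ_) (wVerts-reverse p) x∈)

  wEdges-reverse⊆ : ∀ {u v} (p : Walk G u v) → wEdges G (reverseʷ p) ⊆ˡ wEdges G p
  wEdges-reverse⊆ p e∈ = Any.reverse⁻ (subst (_ ∈ˡ_) (wEdges-reverse p) e∈)

  IsPath-reverse : ∀ {u v} (p : Walk G u v) → IsPath G p → IsPath G (reverseʷ p)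
  IsPath-reverse p path = subst Unique (sym (wVerts-reverse p))
    (Unique-resp-↭ (setoid (Fin n)) (↭-sym (setoid (Fin n)) (↭-reverse (setoid (Fin n)) (wVerts G p))) path)

  IsPath⇒length≤n : ∀ {u v} {p : Walk G u v} → IsPath G p → length (wVerts G p) ≤ n
  IsPath⇒length≤n {p = p} path =
    subst (length (wVerts G p) ≤_) (∣⊤∣≡n n) (length≤∣p∣ _ path (All.tabulate λ _ → ∈⊤))

  IsPath-++ : ∀ {u v w} (p : Walk G u v) (q : Walk G v w) → IsPath G p → IsPath G q →
    (∀ {z} → z ∈ˡ wVerts G p → z ∈ˡ wVerts G q → z ≡ v) → IsPath G (p ++ʷ q)
  IsPath-++ []               q _                qpath _      = qpath
  IsPath-++ {u} (step e j p) q (u∉p ∷ ppath) qpath meet-at-v =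
    All.tabulate u∉p++q ∷ IsPath-++ p q ppath qpath (meet-at-v ∘ there)
    where
    u∉p++q : ∀ {z} → z ∈ˡ wVerts G (p ++ʷ q) → u ≢ z
    u∉p++q z∈ refl with wVerts-++⁻ p q z∈
    ... | inj₁ u∈p = All.lookup u∉p u∈p refl
    ... | inj₂ u∈q =
      All.lookup u∉p (subst (_∈ˡ wVerts G p) (sym (meet-at-v (here refl) u∈q)) (end∈wVerts p)) refl

  ∉wVerts⇒¬Joins : ∀ {u w v g b} (p : Walk G w v) → All (u ≢_) (wVerts G p) → g ∈ˡ wEdges G p →
    ¬ Joins G g u b
  ∉wVerts⇒¬Joins p u∉p g∈p jg = All.lookup u∉p (proj₁ (Joins⇒∈wVerts p g∈p jg)) refl

  start-edge-unique : ∀ {u w v f g b} (jf : Joins G f u w) (p : Walk G w v) → IsPath G (step f jf p) →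
    g ∈ˡ wEdges G (step f jf p) → Joins G g u b → g ≡ f
  start-edge-unique _ p _         (here refl) _  = refl
  start-edge-unique _ p (u∉p ∷ _) (there g∈p) jg = ⊥-elim (∉wVerts⇒¬Joins p u∉p g∈p jg)

  prefix : ∀ {u v x} (p : Walk G u v) → x ∈ˡ wVerts G p → Σ (Walk G u x) λ q → wEdges G q ⊆ˡ wEdges G p
  prefix []           (here refl) = [] , λ ()
  prefix (step e j p) (here refl) = [] , λ ()
  prefix (step e j p) (there x∈)  with prefix p x∈
  ... | q , q⊆p = step e j q , ∷⁺ʳ e q⊆p

  suffix : ∀ {u v x} (p : Walk G u v) → IsPath G p → x ∈ˡ wVerts G p →
    Σ (Walk G x v) λ q → IsPath G q × wEdges G q ⊆ˡ wEdges G p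
  suffix []           path       (here refl) = [] , path , ⊆-refl
  suffix (step e j p) path       (here refl) = step e j p , path , ⊆-refl
  suffix (step e j p) (_ ∷ path) (there x∈)  with suffix p path x∈
  ... | q , qpath , q⊆p = q , qpath , ⊆-trans q⊆p (xs⊆x∷xs _ e)

  shortcut : ∀ {u v} (p : Walk G u v) → Σ (Walk G u v) λ q → IsPath G q × wEdges G q ⊆ˡ wEdges G p
  shortcut []               = [] , [] ∷ [] , ⊆-refl
  shortcut (step {u} e j p) with shortcut p
  ... | q , qpath , q⊆p with u ∈? wVerts G q
  ...   | no  u∉q = step e j q , ¬Any⇒All¬ _ u∉q ∷ qpath , ∷⁺ʳ e q⊆p
  ...   | yes u∈q with suffix q qpath u∈q
  ...     | r , rpath , r⊆q = r , rpath , ⊆-trans r⊆q (⊆-trans q⊆p (xs⊆x∷xs _ e))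

  internal-TwoEdgesAt : ∀ {u v x} (p : Walk G u v) → IsPath G p → x ∈ˡ wVerts G p → x ≢ u → x ≢ v →
    TwoEdgesAt (_∈ˡ wEdges G p) x
  internal-TwoEdgesAt []           _ (here refl) x≢u _ = ⊥-elim (x≢u refl)
  internal-TwoEdgesAt (step e j p) _ (here refl) x≢u _ = ⊥-elim (x≢u refl)
  internal-TwoEdgesAt {u} {x = x} (step {w = w} e j p) (u∉p ∷ path) (there x∈p) _ x≢v with x ≟ w
  ... | no x≢w   = TwoEdgesAt-map there (internal-TwoEdgesAt p path x∈p x≢w x≢v)
  ... | yes refl = at-second-vertex p u∉p x≢v
    where
    at-second-vertex : ∀ {v} (p : Walk G x v) → All (u ≢_) (wVerts G p) → x ≢ v →
      TwoEdgesAt (_∈ˡ wEdges G (step e j p)) x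
    at-second-vertex []               _   x≢v = ⊥-elim (x≢v refl)
    at-second-vertex (step e′ j′ p′) u∉p _   = twoEdges e≢e′ (here refl) (there (here refl)) (Joins-sym j) j′
      where
      e≢e′ : e ≢ e′
      e≢e′ refl = ∉wVerts⇒¬Joins (step e′ j′ p′) u∉p (here refl) j

  path-internal⇒Interior : ∀ {T u v x} (p : Walk G u v) → InSub G T p → IsPath G p → x ∈ˡ wVerts G p →
    x ≢ u → x ≢ v → Interior G T x
  path-internal⇒Interior {T} p p⊆T path x∈p x≢u x≢v =
    TwoEdgesAt⇒Interior {T = T} (TwoEdgesAt-map (All.lookup p⊆T) (internal-TwoEdgesAt p path x∈p x≢u x≢v))

  crossing-edge : ∀ {Q : Fin n → Set} → Decidable Q → ∀ {y z} (p : Walk G y z) → ¬ Q y → Q z →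
    ∃₂ λ a b → ∃ λ h → h ∈ˡ wEdges G p × Joins G h a b × ¬ Q a × Q b
  crossing-edge Q? []                            ¬Qy Qz = ⊥-elim (¬Qy Qz)
  crossing-edge Q? (step {u = y} {w = w} h j p) ¬Qy Qz with Q? w
  ... | yes Qw  = y , w , h , here refl , j , ¬Qy , Qw
  ... | no  ¬Qw with crossing-edge Q? p ¬Qw Qz
  ...   | a , b , h′ , h′∈ , j′ , ¬Qa , Qb = a , b , h′ , there h′∈ , j′ , ¬Qa , Qb

  -- Trees

  NoParallel : Subgraph G → Set
  NoParallel T = ∀ {e f} → e ∈ edges T → f ∈ edges T → e ∥ f → e ≡ f

  module _ {T : Subgraph G} (tree : IsTree G T) where

    tree-ends∈verts : ∀ {e u w} → e ∈ edges T → Joins G e u w → u ∈ verts T × w ∈ verts T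
    tree-ends∈verts = proj₁ tree _ _ _

    tree-walk : ∀ {u v} → u ∈ verts T → v ∈ verts T → Σ (Walk G u v) (InSub G T)
    tree-walk = proj₁ (proj₂ (proj₂ tree)) _ _

    tree-no-cycle : ∀ {e u w} → e ∈ edges T → Joins G e u w →
      (q : Walk G w u) → InSub G T q → All (_≢ e) (wEdges G q) → ⊥
    tree-no-cycle {e} {u} {w} e∈T j q q⊆T e∉q with shortcut q
    ... | q′ , q′path , q′⊆q =
      proj₂ (proj₂ (proj₂ tree)) e u w e∈T j
        ((q′ , anti-mono q′⊆q q⊆T , q′path) , anti-mono q′⊆q e∉q)

    Interior⇒∈verts : ∀ {v} → Interior G T v → v ∈ verts T
    Interior⇒∈verts = ends∈verts ∘ Interior⇒TwoEdgesAt {T = T}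
      where
      ends∈verts : ∀ {v} → TwoEdgesAt (_∈ edges T) v → v ∈ verts T
      ends∈verts (twoEdges _ e∈T _ je _) = proj₁ (tree-ends∈verts e∈T je)

    tree⇒NoParallel : NoParallel T
    tree⇒NoParallel {e} {f} e∈T f∈T e∥f with e ≟ f
    ... | yes e≡f = e≡f
    ... | no  e≢f =
      ⊥-elim (tree-no-cycle e∈T (Joins-ends e) (step f (Joins-sym e∥f) []) (f∈T ∷ []) ((e≢f ∘ sym) ∷ []))

    interior-end : ∀ {g a b w} → g ∈ edges T → Joins G g a b → w ∈ verts T → w ≢ a → w ≢ b →
      Interior G T a ⊎ Interior G T b
    interior-end {g} {a} {b} g∈T jg w∈T w≢a w≢b with tree-walk w∈T (proj₁ (tree-ends∈verts g∈T jg))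
    ... | p , p⊆T with crossing-edge (λ x → (x ≟ a) ⊎-dec (x ≟ b)) p [ w≢a , w≢b ] (inj₁ refl)
    ... | y , z , h , h∈p , jh , y∉ab , z∈ab = at z∈ab
      where
      h∈T : h ∈ edges T
      h∈T = All.lookup p⊆T h∈p
      h≢g : h ≢ g
      h≢g refl with Joins-unique jh jg
      ... | inj₁ (y≡a , _) = y∉ab (inj₁ y≡a)
      ... | inj₂ (y≡b , _) = y∉ab (inj₂ y≡b)
      at : z ≡ a ⊎ z ≡ b → Interior G T a ⊎ Interior G T b
      at (inj₁ refl) = inj₁ (TwoEdgesAt⇒Interior {T = T} (twoEdges h≢g h∈T g∈T (Joins-sym jh) jg))
      at (inj₂ refl) = inj₂ (TwoEdgesAt⇒Interior {T = T} (twoEdges h≢g h∈T g∈T (Joins-sym jh) (Joins-sym jg)))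

  record Branch (T : Subgraph G) (v x : Fin n) : Set where
    constructor branch
    field
      first  : Fin m
      next   : Fin n
      joins  : Joins G first v next
      rest   : Walk G next x
      isPath : IsPath G (step first joins rest)
      inT    : InSub G T (step first joins rest)

    walk : Walk G v x
    walk = step first joins rest

    end≢root : x ≢ v
    end≢root x≡v with isPath
    ... | v∉rest ∷ _ = All.lookup v∉rest (end∈wVerts rest) (sym x≡v)

  open Branch

  module _ {T : Subgraph G} (tree : IsTree G T) where

    branch-to : ∀ {v x} → v ∈ verts T → x ∈ verts T → x ≢ v → Branch T v x
    branch-to v∈T x∈T x≢v with tree-walk tree v∈T x∈T
    ... | p , p⊆T with shortcut p
    ...   | []         , _     , _   = ⊥-elim (x≢v refl)
    ...   | step e j q , qpath , q⊆p = branch e _ j q qpath (anti-mono q⊆p p⊆T)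

    branches-meet-at-root : ∀ {v x y z} (P : Branch T v x) (Q : Branch T v y) → first P ≢ first Q →
      z ∈ˡ wVerts G (walk P) → z ∈ˡ wVerts G (walk Q) → z ≡ v
    branches-meet-at-root _ _ _ (here refl) _           = refl
    branches-meet-at-root _ _ _ (there _)   (here refl) = refl
    -- The two branches, cut at z and closed up by f, form a cycle through e.
    branches-meet-at-root {v} (branch e a je p ppath p⊆T) (branch f b jf q qpath q⊆T) e≢f
                          (there z∈p) (there z∈q)
      with prefix p z∈p | prefix q z∈q
    ... | p′ , p′⊆p | q′ , q′⊆q =
      ⊥-elim (tree-no-cycle tree (All.lookup p⊆T (here refl)) je cycle
                (All.tabulate cycle⊆T) (All.tabulate cycle∌e))
      where
      cycle : Walk G a v
      cycle = p′ ++ʷ reverseʷ q′ ++ʷ step f (Joins-sym jf) []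
      classify : ∀ {g} → g ∈ˡ wEdges G cycle → g ∈ˡ wEdges G p ⊎ g ∈ˡ wEdges G q ⊎ g ≡ f
      classify g∈ with wEdges-++⁻ p′ _ g∈
      ... | inj₁ g∈p′ = inj₁ (p′⊆p g∈p′)
      ... | inj₂ g∈q′f with wEdges-++⁻ (reverseʷ q′) _ g∈q′f
      ...   | inj₁ g∈q′        = inj₂ (inj₁ (q′⊆q (wEdges-reverse⊆ q′ g∈q′)))
      ...   | inj₂ (here refl) = inj₂ (inj₂ refl)
      cycle⊆T : ∀ {g} → g ∈ˡ wEdges G cycle → g ∈ edges T
      cycle⊆T g∈ with classify g∈
      ... | inj₁ g∈p        = All.lookup p⊆T (there g∈p)
      ... | inj₂ (inj₁ g∈q) = All.lookup q⊆T (there g∈q)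
      ... | inj₂ (inj₂ refl) = All.lookup q⊆T (here refl)
      cycle∌e : ∀ {g} → g ∈ˡ wEdges G cycle → g ≢ e
      cycle∌e g∈ refl with classify g∈
      ... | inj₁ e∈p         = ∉wVerts⇒¬Joins p (head ppath) e∈p je
      ... | inj₂ (inj₁ e∈q)  = ∉wVerts⇒¬Joins q (head qpath) e∈q je
      ... | inj₂ (inj₂ e≡f)  = e≢f e≡f

    first-unique : ∀ {v x} (P Q : Branch T v x) → first P ≡ first Q
    first-unique P Q with first P ≟ first Q
    ... | yes eq = eq
    ... | no  ne =
      ⊥-elim (end≢root P (branches-meet-at-root P Q ne (end∈wVerts (walk P)) (end∈wVerts (walk Q))))

    path-through-root : ∀ {v x y} (P : Branch T v x) (Q : Branch T v y) → first P ≢ first Q →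
      Σ (PathIn G T x y) λ W → v ∈ˡ wVerts G (proj₁ W)
    path-through-root {v} {x} {y} P Q P≢Q =
      (W , All.tabulate W⊆T ,
       IsPath-++ (reverseʷ (walk P)) (walk Q) (IsPath-reverse (walk P) (isPath P)) (isPath Q) meet) ,
      wVerts-++⁺ʳ (reverseʷ (walk P)) (walk Q) (here refl)
      where
      W : Walk G x y
      W = reverseʷ (walk P) ++ʷ walk Q
      meet : ∀ {z} → z ∈ˡ wVerts G (reverseʷ (walk P)) → z ∈ˡ wVerts G (walk Q) → z ≡ v
      meet z∈P z∈Q = branches-meet-at-root P Q P≢Q (wVerts-reverse⊆ (walk P) z∈P) z∈Q
      W⊆T : ∀ {g} → g ∈ˡ wEdges G W → g ∈ edges T
      W⊆T g∈ with wEdges-++⁻ (reverseʷ (walk P)) (walk Q) g∈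
      ... | inj₁ g∈P = All.lookup (inT P) (wEdges-reverse⊆ (walk P) g∈P)
      ... | inj₂ g∈Q = All.lookup (inT Q) g∈Q

  module _ {R : Subset n} {T : Subgraph G} (tree : IsTree G T)
           (leaves∈R : ∀ v → v ∈ verts T → deg G T v ≡ 1 → v ∈ R) where

    nonterminal-Interior : ∀ {f z y} → f ∈ edges T → Joins G f z y → z ∉ R → Interior G T z
    nonterminal-Interior f∈T jf z∉R with deg≡1⊎Interior {T = T} f∈T jf
    ... | inj₁ deg≡1   = ⊥-elim (z∉R (leaves∈R _ (proj₁ (tree-ends∈verts tree f∈T jf)) deg≡1))
    ... | inj₂ interior = interior

    another-edge : ∀ {f z y} → f ∈ edges T → Joins G f z y → z ∉ R →
      ∃₂ λ h y′ → h ∈ edges T × Joins G h z y′ × h ≢ f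
    another-edge {f} {z} f∈T jf z∉R =
      avoid-f (Interior⇒TwoEdgesAt {T = T} (nonterminal-Interior f∈T jf z∉R))
      where
      avoid-f : TwoEdgesAt (_∈ edges T) z → ∃₂ λ h y′ → h ∈ edges T × Joins G h z y′ × h ≢ f
      avoid-f (twoEdges {g} {h} g≢h g∈T h∈T jg jh) with g ≟ f
      ... | yes refl = h , _ , h∈T , jh , g≢h ∘ sym
      ... | no  g≢f  = g , _ , g∈T , jg , g≢f

    -- The walk q grows backwards from a: q ++ʷ back is a T-path from its tip z to v ending with e.
    module _ {e v a} (e∈T : e ∈ edges T) (je : Joins G e v a) where

      back : Walk G a v
      back = step e (Joins-sym je) []

      leading-edge : ∀ {z} → Walk G z a → Fin m
      leading-edge []           = e
      leading-edge (step g _ _) = g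

      leading-edge-at-tip : ∀ {z} (q : Walk G z a) → InSub G T (q ++ʷ back) →
        leading-edge q ∈ edges T × ∃ (Joins G (leading-edge q) z)
      leading-edge-at-tip []           (e∈T ∷ _) = e∈T , v , Joins-sym je
      leading-edge-at-tip (step g j q) (g∈T ∷ _) = g∈T , _ , j

      other-edges-avoid : ∀ {z y h} (q : Walk G z a) → IsPath G (q ++ʷ back) → Joins G h z y →
        h ≢ leading-edge q → All (_≢ h) (wEdges G (q ++ʷ back))
      other-edges-avoid []           path jh h≢e =
        All.tabulate λ { g∈ refl → h≢e (start-edge-unique (Joins-sym je) [] path g∈ jh) }
      other-edges-avoid (step g j q) path jh h≢g =
        All.tabulate λ { g∈ refl → h≢g (start-edge-unique j (q ++ʷ back) path g∈ jh) }

      fresh-end : ∀ {z y h} (q : Walk G z a) → IsPath G (q ++ʷ back) → InSub G T (q ++ʷ back) →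
        h ∈ edges T → Joins G h z y → h ≢ leading-edge q → All (y ≢_) (wVerts G (q ++ʷ back))
      fresh-end q path q⊆T h∈T jh h≢ = All.tabulate λ { y∈ refl →
        let (p , p⊆q) = prefix (q ++ʷ back) y∈
        in tree-no-cycle tree h∈T (Joins-sym jh) p (anti-mono p⊆q q⊆T)
             (anti-mono p⊆q (other-edges-avoid q path jh h≢)) }

      TerminalVia : Set
      TerminalVia = ∃ λ r → r ∈ R × Σ (Branch T v r) λ P → first P ≡ e

      reversed-branch : ∀ {z} (q : Walk G z a) → IsPath G (q ++ʷ back) → InSub G T (q ++ʷ back) →
        Branch T v z
      reversed-branch q path q⊆T =
        branch e a (Joins-sym (Joins-sym je)) (reverseʷ q)
          (subst (IsPath G) (reverseʷ-∷ʳ q (Joins-sym je)) (IsPath-reverse _ path))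
          (subst (InSub G T) (reverseʷ-∷ʳ q (Joins-sym je)) (anti-mono (wEdges-reverse⊆ _) q⊆T))

      -- The path q ++ʷ back grows by one vertex per step, so the fuel n suffices.
      walk-away : (fuel : ℕ) → ∀ {z} (q : Walk G z a) → IsPath G (q ++ʷ back) →
        InSub G T (q ++ʷ back) → n < length (wVerts G (q ++ʷ back)) + fuel → TerminalVia
      walk-away zero       q path _   bound =
        ⊥-elim (<⇒≱ (subst (n <_) (+-identityʳ _) bound) (IsPath⇒length≤n path))
      walk-away (suc fuel) {z} q path q⊆T bound = stop-or-extend (z ∈ₛ? R)
        where
        extend : (∃₂ λ h y → h ∈ edges T × Joins G h z y × h ≢ leading-edge q) → TerminalVia
        extend (h , y , h∈T , jh , h≢f) =
          walk-away fuel (step h (Joins-sym jh) q) (fresh-end q path q⊆T h∈T jh h≢f ∷ path) (h∈T ∷ q⊆T)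
            (subst (n <_) (+-suc _ fuel) bound)
        stop-or-extend : Dec (z ∈ R) → TerminalVia
        stop-or-extend (yes z∈R) = z , z∈R , reversed-branch q path q⊆T , refl
        stop-or-extend (no  z∉R) with leading-edge-at-tip q q⊆T
        ... | f∈T , _ , jf = extend (another-edge f∈T jf z∉R)

      terminal-via : TerminalVia
      terminal-via = walk-away n [] ((Joins⇒≢ (Joins-sym je) ∷ []) ∷ [] ∷ []) (e∈T ∷ []) (s≤s (n≤1+n n))

  -- R-parallel subgraphs

  _withEdges_ : Subgraph G → Subset m → Subgraph G
  A withEdges E = record { verts = verts A ; edges = E }

  module _ {R : Subset n} where

    EdgeOfGR? : Decidable (EdgeOfGR G R)
    EdgeOfGR? e = (end₁ e ∈ₛ? R) ×-dec (end₂ e ∈ₛ? R)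

    EdgeOfGR-Joins : ∀ {e a b} → EdgeOfGR G R e → Joins G e a b → a ∈ R × b ∈ R
    EdgeOfGR-Joins {e} (e₁∈R , e₂∈R) j with Joins-unique j (Joins-ends e)
    ... | inj₁ (refl , refl) = e₁∈R , e₂∈R
    ... | inj₂ (refl , refl) = e₂∈R , e₁∈R

    EdgeOfGR-∥ : ∀ {e f} → e ∥ f → EdgeOfGR G R e → EdgeOfGR G R f
    EdgeOfGR-∥ e∥f GR = EdgeOfGR-Joins GR (∥-sym e∥f)

    RParallel-sym : ∀ {A B} → RParallel G R A B → RParallel G R B A
    RParallel-sym par e = ⇔-sym ∘ proj₁ (par e) , ⇔-sym ∘ proj₂ (par e)

    module _ {A B : Subgraph G} where

      RParallel-edge : RParallel G R A B → ∀ {e u w} → e ∈ edges A → Joins G e u w →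
        ∃ λ f → f ∈ edges B × Joins G f u w
      RParallel-edge par {e} e∈A j with EdgeOfGR? e
      ... | no  ¬GR = e , Equivalence.to (proj₁ (par e) ¬GR) e∈A , j
      ... | yes GR with Equivalence.to (proj₂ (par e) GR) (e , e∈A , ∥-refl e)
      ...   | f , f∈B , e∥f = f , f∈B , ∥-Joins e∥f j

      RParallel-TwoEdgesAt : RParallel G R A B → NoParallel A → ∀ {x} →
        TwoEdgesAt (_∈ edges A) x → TwoEdgesAt (_∈ edges B) x
      RParallel-TwoEdgesAt par noParA (twoEdges e≢e′ e∈A e′∈A je je′)
        with RParallel-edge par e∈A je | RParallel-edge par e′∈A je′
      ... | f , f∈B , jf | f′ , f′∈B , jf′ = twoEdges f≢f′ f∈B f′∈B jf jf′
        where
        f≢f′ : f ≢ f′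
        f≢f′ refl with Joins-unique jf jf′
        ... | inj₁ (_ , refl)  = e≢e′ (noParA e∈A e′∈A (Joins⇒∥ je je′))
        ... | inj₂ (x≡z , _) = Joins⇒≢ je′ x≡z

      RParallel-Interior : RParallel G R A B → NoParallel A → ∀ {x} → Interior G A x → Interior G B x
      RParallel-Interior par noParA =
        TwoEdgesAt⇒Interior {T = B} ∘ RParallel-TwoEdgesAt par noParA ∘ Interior⇒TwoEdgesAt {T = A}

      RParallel-walk : RParallel G R A B → ∀ {u v} (p : Walk G u v) → InSub G A p →
        Σ (Walk G u v) λ p′ → InSub G B p′ ×
          (∀ {f} → f ∈ˡ wEdges G p′ → ∃ λ g → g ∈ˡ wEdges G p × g ∥ f)
      RParallel-walk par []           _          = [] , [] , λ ()
      RParallel-walk par (step e j p) (e∈A ∷ p⊆A) with RParallel-edge par e∈A j | RParallel-walk par p p⊆A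
      ... | f , f∈B , jf | p′ , p′⊆B , p′∥p = step f jf p′ , f∈B ∷ p′⊆B , step∥
        where
        step∥ : ∀ {g′} → g′ ∈ˡ wEdges G (step f jf p′) →
          ∃ λ g → g ∈ˡ wEdges G (step e j p) × g ∥ g′
        step∥ (here refl) = e , here refl , Joins⇒∥ j jf
        step∥ (there g′∈) with p′∥p g′∈
        ... | g , g∈p , g∥g′ = g , there g∈p , g∥g′

    RParallel-leaves : ∀ {A B} → RParallel G R A B → IsTree G B →
      (∀ v → v ∈ verts B → deg G B v ≡ 1 → v ∈ R) → ∀ v → v ∈ verts A → deg G A v ≡ 1 → v ∈ R
    RParallel-leaves {A} {B} par treeB leavesB v _ degA≡1
      with 0<deg⇒edge {T = A} (subst (0 <_) (sym degA≡1) (s≤s z≤n))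
    ... | e , y , e∈A , je with RParallel-edge {A = A} {B = B} par e∈A je
    ... | f , f∈B , jf with deg≡1⊎Interior {T = B} f∈B jf
    ...   | inj₁ degB≡1    = leavesB v (proj₁ (tree-ends∈verts treeB f∈B jf)) degB≡1
    ...   | inj₂ interiorB = ⊥-elim (<⇒≱ (subst (2 ≤_) degA≡1 interiorA) ≤-refl)
      where
      interiorA : Interior G A v
      interiorA =
        RParallel-Interior {A = B} {B = A} (RParallel-sym {A = A} {B = B} par) (tree⇒NoParallel treeB) interiorB

    RParallel-terminals : ∀ {A B} → RParallel G R A B → 1 < ∣ R ∣ → IsTree G A → R ⊆ verts A → IsTree G B →
      R ⊆ verts B
    RParallel-terminals {A} {B} par 1<∣R∣ treeA R⊆A treeB {r} r∈R with ∃-∈-avoiding R (r ∷ []) 1<∣R∣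
    ... | w , w∈R , w≢r ∷ [] with tree-walk treeA (R⊆A r∈R) (R⊆A w∈R)
    ...   | []         , _         = ⊥-elim (w≢r refl)
    ...   | step e j _ , e∈A ∷ _ with RParallel-edge {A = A} {B = B} par e∈A j
    ...     | f , f∈B , jf = proj₁ (tree-ends∈verts treeB f∈B jf)

    RParallel-IsTree : ∀ {A : Subgraph G} {E : Subset m} → RParallel G R A (A withEdges E) → IsTree G A →
      NoParallel (A withEdges E) → IsTree G (A withEdges E)
    RParallel-IsTree {A} {E} par treeA noParB = ends∈ , proj₁ (proj₂ treeA) , connected , acyclic
      where
      B : Subgraph G
      B = A withEdges E
      par⁻¹ : RParallel G R B A
      par⁻¹ = RParallel-sym {A = A} {B = B} par
      ends∈ : ∀ e u w → e ∈ E → Joins G e u w → u ∈ verts A × w ∈ verts A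
      ends∈ e u w e∈B j with RParallel-edge {A = B} {B = A} par⁻¹ e∈B j
      ... | f , f∈A , jf = tree-ends∈verts treeA f∈A jf
      connected : ∀ u v → u ∈ verts A → v ∈ verts A → Σ (Walk G u v) (InSub G B)
      connected u v u∈A v∈A with tree-walk treeA u∈A v∈A
      ... | p , p⊆A with RParallel-walk {A = A} {B = B} par p p⊆A
      ...   | p′ , p′⊆B , _ = p′ , p′⊆B
      acyclic : ∀ e u w → e ∈ E → Joins G e u w →
        ¬ Σ (PathIn G B w u) (λ P → All (_≢ e) (wEdges G (proj₁ P)))
      acyclic e u w e∈B je ((p , p⊆B , _) , p∌e)
        with RParallel-edge {A = B} {B = A} par⁻¹ e∈B je | RParallel-walk {A = B} {B = A} par⁻¹ p p⊆B
      ... | ê , ê∈A , jê | p′ , p′⊆A , p∥p′ =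
        tree-no-cycle treeA ê∈A jê p′ p′⊆A (All.tabulate p′∌ê)
        where
        p′∌ê : ∀ {f} → f ∈ˡ wEdges G p′ → f ≢ ê
        p′∌ê f∈ refl with p∥p′ f∈
        ... | g , g∈p , g∥ê =
          All.lookup p∌e g∈p (noParB (All.lookup p⊆B g∈p) e∈B (∥-trans g∥ê (Joins⇒∥ jê je)))

  -- From an R-CIST to an R-IDST

  TerminalBesides : Subset n → Fin n → Set
  TerminalBesides R v = ∃ λ x → x ∈ R × x ≢ v

  module Sectors {R : Subset n} {T : Subgraph G} (steiner : IsSteinerTree G R T)
                 {v : Fin n} (v∈T : v ∈ verts T) where

    private
      tree : IsTree G T
      tree = proj₁ steiner
      R⊆T : R ⊆ verts T
      R⊆T = proj₁ (proj₂ steiner)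

    branch-from-v : (x : TerminalBesides R v) → Branch T v (proj₁ x)
    branch-from-v (x , x∈R , x≢v) = branch-to tree v∈T (R⊆T x∈R) x≢v

    sector : TerminalBesides R v → Fin m
    sector = first ∘ branch-from-v

    sector-via : ∀ {e a} → e ∈ edges T → Joins G e v a → ∃ λ x → sector x ≡ e
    sector-via {e} e∈T je = sector-of (terminal-via tree (proj₂ (proj₂ steiner)) e∈T je)
      where
      sector-of : TerminalVia tree (proj₂ (proj₂ steiner)) e∈T je → ∃ λ x → sector x ≡ e
      sector-of (r , r∈R , P , first≡e) = x , trans (first-unique tree (branch-from-v x) P) first≡e
        where
        x : TerminalBesides R v
        x = r , r∈R , end≢root P

    Interior⇒two-sectors : Interior G T v → ∃₂ λ x y → sector x ≢ sector y
    Interior⇒two-sectors = two-sectors ∘ Interior⇒TwoEdgesAt {T = T}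
      where
      two-sectors : TwoEdgesAt (_∈ edges T) v → ∃₂ λ x y → sector x ≢ sector y
      two-sectors (twoEdges e≢f e∈T f∈T je jf) =
        proj₁ (sector-via e∈T je) , proj₁ (sector-via f∈T jf) ,
        λ eq → e≢f (trans (sym (proj₂ (sector-via e∈T je))) (trans eq (proj₂ (sector-via f∈T jf))))

    distinct-sectors⇒≢ : ∀ x y → sector x ≢ sector y → proj₁ x ≢ proj₁ y
    distinct-sectors⇒≢ x y ne refl = ne (first-unique tree (branch-from-v x) (branch-from-v y))

    path-through-v : ∀ x y → sector x ≢ sector y →
      Σ (PathIn G T (proj₁ x) (proj₁ y)) λ W → v ∈ˡ wVerts G (proj₁ W)
    path-through-v x y = path-through-root tree (branch-from-v x) (branch-from-v y)

  CIST⇒interiors-disjoint : ∀ {R k T′} → IsCIST G R k T′ → ∀ i j → i ≢ j → ∀ v →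
    ¬ (Interior G (T′ i) v × Interior G (T′ j) v)
  CIST⇒interiors-disjoint {R} {T′ = T′} (steiner , cist) i j i≢j v (int-i , int-j) =
    separated-in-both (common-split _≟_ _≟_ Sᵢ.sector Sⱼ.sector
      (Sᵢ.Interior⇒two-sectors int-i) (Sⱼ.Interior⇒two-sectors int-j))
    where
    module Sᵢ = Sectors (steiner i) (Interior⇒∈verts (proj₁ (steiner i)) int-i)
    module Sⱼ = Sectors (steiner j) (Interior⇒∈verts (proj₁ (steiner j)) int-j)
    separated-in-both : (∃₂ λ x y → Sᵢ.sector x ≢ Sᵢ.sector y × Sⱼ.sector x ≢ Sⱼ.sector y) → ⊥
    separated-in-both ((x , x∈R , x≢v) , (y , y∈R , y≢v) , sepᵢ , sepⱼ) =
      v-not-shared (Sᵢ.path-through-v _ _ sepᵢ) (Sⱼ.path-through-v _ _ sepⱼ)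
      where
      v-not-shared : Σ (PathIn G (T′ i) x y) (λ W → v ∈ˡ wVerts G (proj₁ W)) →
                     Σ (PathIn G (T′ j) x y) (λ W → v ∈ˡ wVerts G (proj₁ W)) → ⊥
      v-not-shared (Pᵢ , v∈Pᵢ) (Pⱼ , v∈Pⱼ) =
        [ x≢v ∘ sym , y≢v ∘ sym ]
          (proj₂ (cist x y x∈R y∈R (Sᵢ.distinct-sectors⇒≢ _ _ sepᵢ) i j i≢j Pᵢ Pⱼ) v v∈Pᵢ v∈Pⱼ)

  CIST⇒IDST : ∀ {R S k} {T′ T : Fin k → Subgraph G} → 1 < ∣ R ∣ → IsCIST G R k T′ →
    (∀ i → IsTreeOfSimple G S (T i)) → (∀ i → RParallel G R (T i) (T′ i)) → IsIDST G S R k T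
  CIST⇒IDST {R} {S} {T′ = T′} {T} 1<∣R∣ cist simple par = steiner , disjoint
    where
    steiner′ : ∀ i → IsSteinerTree G R (T′ i)
    steiner′ = proj₁ cist
    par⁻¹ : ∀ i → RParallel G R (T′ i) (T i)
    par⁻¹ i = RParallel-sym {A = T i} {B = T′ i} (par i)
    steiner : ∀ i → IsSteinerTree G R (T i) × edges (T i) ⊆ S
    steiner i with steiner′ i
    ... | tree′ , R⊆T′ , leaves′ =
      (proj₁ (simple i) ,
       RParallel-terminals {A = T′ i} {B = T i} (par⁻¹ i) 1<∣R∣ tree′ R⊆T′ (proj₁ (simple i)) ,
       RParallel-leaves {A = T i} {B = T′ i} (par i) tree′ leaves′) ,
      proj₂ (simple i)
    Interior⇒Interior′ : ∀ i {v} → Interior G (T i) v → Interior G (T′ i) v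
    Interior⇒Interior′ i =
      RParallel-Interior {A = T i} {B = T′ i} (par i) (tree⇒NoParallel (proj₁ (simple i)))
    disjoint : ∀ i j → i ≢ j → ∀ v → ¬ (Interior G (T i) v × Interior G (T j) v)
    disjoint i j i≢j v (int-i , int-j) =
      CIST⇒interiors-disjoint cist i j i≢j v (Interior⇒Interior′ i int-i , Interior⇒Interior′ j int-j)

  -- From an R-IDST to an R-CIST

  module _ {R : Subset n} (3≤∣R∣ : 3 ≤ ∣ R ∣) (doubled : TerminalsDoubled G R)
           {S : Subset m} (simple : IsUnderlyingSimple G S) where

    rep : Fin m → Fin m
    rep e = proj₁ (proj₁ simple e)

    rep∈S : ∀ e → rep e ∈ S
    rep∈S e = proj₁ (proj₂ (proj₁ simple e))

    ∥-rep : ∀ e → e ∥ rep e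
    ∥-rep e = proj₂ (proj₂ (proj₁ simple e))

    rep-id : ∀ {e} → e ∈ S → rep e ≡ e
    rep-id {e} e∈S = sym (proj₂ simple e (rep e) e∈S (rep∈S e) (∥-rep e))

    rep-resp-∥ : ∀ {e f} → e ∥ f → rep e ≡ rep f
    rep-resp-∥ {e} {f} e∥f =
      proj₂ simple (rep e) (rep f) (rep∈S e) (rep∈S f) (∥-trans (∥-sym (∥-rep e)) (∥-trans e∥f (∥-rep f)))

    ∥-∈S⇒≡ : ∀ {e f} → e ∥ f → e ∈ S → f ∈ S → e ≡ f
    ∥-∈S⇒≡ {e} {f} e∥f e∈S f∈S = proj₂ simple e f e∈S f∈S e∥f

    copies : Fin m → Subset m
    copies e = tabulate (does ∘ λ f → joins? G f (end₁ e) (end₂ e))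

    ∣copies∣≡2 : ∀ {e} → EdgeOfGR G R e → ∣ copies e ∣ ≡ 2
    ∣copies∣≡2 {e} (e₁∈R , e₂∈R) = doubled (end₁ e) (end₂ e) e₁∈R e₂∈R e (Joins-ends e)

    no-third-copy : ∀ {e x y z} → EdgeOfGR G R e → e ∥ x → e ∥ y → e ∥ z → x ≢ y → x ≢ z → y ≢ z → ⊥
    no-third-copy {e} GR e∥x e∥y e∥z x≢y x≢z y≢z =
      <⇒≱ (subst (3 ≤_) (∣copies∣≡2 GR) three≤∣copies∣) ≤-refl
      where
      copy : ∀ {f} → e ∥ f → f ∈ copies e
      copy = ∈-select⁺ (λ f → joins? G f (end₁ e) (end₂ e))
      three≤∣copies∣ : 3 ≤ ∣ copies e ∣
      three≤∣copies∣ = length≤∣p∣ (_ ∷ _ ∷ _ ∷ []) ((x≢y ∷ x≢z ∷ []) ∷ (y≢z ∷ []) ∷ [] ∷ [])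
                                  (copy e∥x ∷ copy e∥y ∷ copy e∥z ∷ [])

    other-copy : ∀ {f} → EdgeOfGR G R f → ∃ λ g → g ≢ f × f ∥ g
    other-copy {f} GR with ∃-∈-avoiding (copies f) (f ∷ []) (subst (2 ≤_) (sym (∣copies∣≡2 GR)) ≤-refl)
    ... | g , g∈ , g≢f ∷ [] = g , g≢f , ∈-select⁻ (λ f′ → joins? G f′ (end₁ f) (end₂ f)) g∈

    module _ {k : ℕ} {T : Fin k → Subgraph G} (idst : IsIDST G S R k T) where

      private
        tree : ∀ i → IsTree G (T i)
        tree i = proj₁ (proj₁ (proj₁ idst i))

        R⊆T : ∀ i → R ⊆ verts (T i)
        R⊆T i = proj₁ (proj₂ (proj₁ (proj₁ idst i)))

        leaves∈R : ∀ i v → v ∈ verts (T i) → deg G (T i) v ≡ 1 → v ∈ R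
        leaves∈R i = proj₂ (proj₂ (proj₁ (proj₁ idst i)))

        T⊆S : ∀ i → edges (T i) ⊆ S
        T⊆S i = proj₂ (proj₁ idst i)

        interiors-disjoint : ∀ i j → i ≢ j → ∀ v → ¬ (Interior G (T i) v × Interior G (T j) v)
        interiors-disjoint = proj₂ idst

      -- Two copies of an edge may list its ends in opposite orders; reading them off rep e
      -- makes all copies agree on which end is the first.
      FirstEndInterior : Fin k → Fin m → Set
      FirstEndInterior i e = Interior G (T i) (end₁ (rep e))

      FirstEndInterior-∥ : ∀ {i e f} → e ∥ f → FirstEndInterior i e → FirstEndInterior i f
      FirstEndInterior-∥ {i} e∥f = subst (λ r → Interior G (T i) (end₁ r)) (rep-resp-∥ e∥f)

      Chosen : Fin k → Fin m → Set
      Chosen i e = (e ∈ S × FirstEndInterior i e) ⊎ (e ∉ S × ¬ FirstEndInterior i e)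

      InT′ : Fin k → Fin m → Set
      InT′ i e = (¬ EdgeOfGR G R e × e ∈ edges (T i)) ⊎ (EdgeOfGR G R e × rep e ∈ edges (T i) × Chosen i e)

      InT′? : ∀ i → Decidable (InT′ i)
      InT′? i e = (¬? (EdgeOfGR? e) ×-dec (e ∈ₛ? edges (T i)))
             ⊎-dec (EdgeOfGR? e ×-dec (rep e ∈ₛ? edges (T i)) ×-dec
                     ((e ∈ₛ? S ×-dec first-end?) ⊎-dec (¬? (e ∈ₛ? S) ×-dec ¬? first-end?)))
        where
        first-end? : Dec (FirstEndInterior i e)
        first-end? = 2 ≤? deg G (T i) (end₁ (rep e))

      T′ : Fin k → Subgraph G
      T′ i = T i withEdges tabulate (does ∘ InT′? i)

      ∈T′⁺ : ∀ {i e} → InT′ i e → e ∈ edges (T′ i)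
      ∈T′⁺ {i} = ∈-select⁺ (InT′? i)

      ∈T′⁻ : ∀ {i e} → e ∈ edges (T′ i) → InT′ i e
      ∈T′⁻ {i} = ∈-select⁻ (InT′? i)

      chosen-copy : ∀ i {f} → EdgeOfGR G R f → f ∈ edges (T i) → ∃ λ g → f ∥ g × InT′ i g
      chosen-copy i {f} GR f∈T = choose (2 ≤? deg G (T i) (end₁ (rep f)))
        where
        f∈S : f ∈ S
        f∈S = T⊆S i f∈T
        repf∈T : rep f ∈ edges (T i)
        repf∈T = subst (_∈ edges (T i)) (sym (rep-id f∈S)) f∈T
        choose : Dec (FirstEndInterior i f) → ∃ λ g → f ∥ g × InT′ i g
        choose (yes int) = f , ∥-refl f , inj₂ (GR , repf∈T , inj₁ (f∈S , int))
        choose (no ¬int) with other-copy GR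
        ... | g , g≢f , f∥g =
          g , f∥g , inj₂ (EdgeOfGR-∥ f∥g GR , subst (_∈ edges (T i)) (rep-resp-∥ f∥g) repf∈T ,
                          inj₂ (g∉S , ¬int ∘ FirstEndInterior-∥ (∥-sym f∥g)))
          where
          g∉S : g ∉ S
          g∉S g∈S = g≢f (sym (∥-∈S⇒≡ f∥g f∈S g∈S))

      T′-parallel : ∀ i → RParallel G R (T i) (T′ i)
      T′-parallel i e =
        (λ ¬GR → mk⇔ (λ e∈T → ∈T′⁺ (inj₁ (¬GR , e∈T))) (from-T′ ¬GR)) ,
        (λ GR → mk⇔ (copy-to-T′ GR) copy-from-T′)
        where
        from-T′ : ¬ EdgeOfGR G R e → e ∈ edges (T′ i) → e ∈ edges (T i)
        from-T′ ¬GR e∈T′ with ∈T′⁻ e∈T′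
        ... | inj₁ (_ , e∈T) = e∈T
        ... | inj₂ (GR , _)  = ⊥-elim (¬GR GR)
        copy-to-T′ : EdgeOfGR G R e → (∃ λ f → f ∈ edges (T i) × e ∥ f) →
          ∃ λ f → f ∈ edges (T′ i) × e ∥ f
        copy-to-T′ GR (f , f∈T , e∥f) with chosen-copy i (EdgeOfGR-∥ e∥f GR) f∈T
        ... | g , f∥g , g∈T′ = g , ∈T′⁺ g∈T′ , ∥-trans e∥f f∥g
        copy-from-T′ : (∃ λ f → f ∈ edges (T′ i) × e ∥ f) → ∃ λ f → f ∈ edges (T i) × e ∥ f
        copy-from-T′ (f , f∈T′ , e∥f) with ∈T′⁻ f∈T′
        ... | inj₁ (_ , f∈T)        = f , f∈T , e∥f
        ... | inj₂ (_ , repf∈T , _) = rep f , repf∈T , ∥-trans e∥f (∥-rep f)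

      T′-NoParallel : ∀ i → NoParallel (T′ i)
      T′-NoParallel i {e} {f} e∈T′ f∈T′ e∥f with ∈T′⁻ e∈T′ | ∈T′⁻ f∈T′
      ... | inj₁ (_ , e∈T)    | inj₁ (_ , f∈T)    = tree⇒NoParallel (tree i) e∈T f∈T e∥f
      ... | inj₁ (¬GRe , _)   | inj₂ (GRf , _)    = ⊥-elim (¬GRe (EdgeOfGR-∥ (∥-sym e∥f) GRf))
      ... | inj₂ (GRe , _)    | inj₁ (¬GRf , _)   = ⊥-elim (¬GRf (EdgeOfGR-∥ e∥f GRe))
      ... | inj₂ (GRe , _ , chosen-e) | inj₂ (_ , _ , chosen-f) = same-choice chosen-e chosen-f
        where
        same-choice : Chosen i e → Chosen i f → e ≡ f
        same-choice (inj₁ (e∈S , _))   (inj₁ (f∈S , _))    = ∥-∈S⇒≡ e∥f e∈S f∈S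
        same-choice (inj₁ (_ , int))   (inj₂ (_ , ¬int))   = ⊥-elim (¬int (FirstEndInterior-∥ e∥f int))
        same-choice (inj₂ (_ , ¬int))  (inj₁ (_ , int))    = ⊥-elim (¬int (FirstEndInterior-∥ (∥-sym e∥f) int))
        same-choice (inj₂ (e∉S , _))   (inj₂ (f∉S , _)) with e ≟ f
        ... | yes e≡f = e≡f
        ... | no  e≢f = ⊥-elim (no-third-copy GRe (∥-refl e) e∥f (∥-rep e) e≢f
                                  (λ e≡rep → e∉S (subst (_∈ S) (sym e≡rep) (rep∈S e)))
                                  (λ f≡rep → f∉S (subst (_∈ S) (sym f≡rep) (rep∈S e))))

      T′-parallel⁻¹ : ∀ i → RParallel G R (T′ i) (T i)
      T′-parallel⁻¹ i = RParallel-sym {A = T i} {B = T′ i} (T′-parallel i)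

      T′-steiner : ∀ i → IsSteinerTree G R (T′ i)
      T′-steiner i =
        RParallel-IsTree (T′-parallel i) (tree i) (T′-NoParallel i) ,
        R⊆T i ,
        RParallel-leaves {A = T′ i} {B = T i} (T′-parallel⁻¹ i) (tree i) (leaves∈R i)

      T′-Interior⇒T-Interior : ∀ i {x} → Interior G (T′ i) x → Interior G (T i) x
      T′-Interior⇒T-Interior i = RParallel-Interior {A = T′ i} {B = T i} (T′-parallel⁻¹ i) (T′-NoParallel i)

      unchosen⇒second-end-Interior : ∀ i {e} → rep e ∈ edges (T i) → ¬ FirstEndInterior i e →
        Interior G (T i) (end₂ (rep e))
      unchosen⇒second-end-Interior i {e} rep∈T ¬int
        with ∃-∈-avoiding R (end₁ (rep e) ∷ end₂ (rep e) ∷ []) 3≤∣R∣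
      ... | w , w∈R , w≢e₁ ∷ w≢e₂ ∷ []
        with interior-end (tree i) rep∈T (Joins-ends (rep e)) (R⊆T i w∈R) w≢e₁ w≢e₂
      ...   | inj₁ int = ⊥-elim (¬int int)
      ...   | inj₂ int = int

      internal-vertices-disjoint : ∀ {u v} i j → i ≢ j →
        (P : PathIn G (T′ i) u v) (Q : PathIn G (T′ j) u v) →
        ∀ x → x ∈ˡ wVerts G (proj₁ P) → x ∈ˡ wVerts G (proj₁ Q) → x ≡ u ⊎ x ≡ v
      internal-vertices-disjoint {u} {v} i j i≢j (p , p⊆T′ , ppath) (q , q⊆T′ , qpath) x x∈p x∈q
        with x ≟ u | x ≟ v
      ... | yes x≡u | _       = inj₁ x≡u
      ... | no  _   | yes x≡v = inj₂ x≡v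
      ... | no  x≢u | no  x≢v = ⊥-elim (interiors-disjoint i j i≢j x
            (T′-Interior⇒T-Interior i (path-internal⇒Interior {T = T′ i} p p⊆T′ ppath x∈p x≢u x≢v) ,
             T′-Interior⇒T-Interior j (path-internal⇒Interior {T = T′ j} q q⊆T′ qpath x∈q x≢u x≢v)))

      edges-disjoint : ∀ {u v} → u ∈ R → v ∈ R → ∀ i j → i ≢ j →
        (P : PathIn G (T′ i) u v) (Q : PathIn G (T′ j) u v) →
        ∀ e → e ∈ˡ wEdges G (proj₁ P) → e ∈ˡ wEdges G (proj₁ Q) → ⊥
      edges-disjoint u∈R v∈R i j i≢j P@(p , p⊆T′ , _) Q@(q , q⊆T′ , _) e e∈p e∈q =
        conflict (∈T′⁻ (All.lookup p⊆T′ e∈p)) (∈T′⁻ (All.lookup q⊆T′ e∈q))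
        where
        shared⇒terminal : ∀ {x} → x ∈ˡ wVerts G p → x ∈ˡ wVerts G q → x ∈ R
        shared⇒terminal x∈p x∈q with internal-vertices-disjoint i j i≢j P Q _ x∈p x∈q
        ... | inj₁ refl = u∈R
        ... | inj₂ refl = v∈R
        GR : EdgeOfGR G R e
        GR with Joins⇒∈wVerts p e∈p (Joins-ends e) | Joins⇒∈wVerts q e∈q (Joins-ends e)
        ... | e₁∈p , e₂∈p | e₁∈q , e₂∈q = shared⇒terminal e₁∈p e₁∈q , shared⇒terminal e₂∈p e₂∈q
        conflict : InT′ i e → InT′ j e → ⊥
        conflict (inj₁ (¬GR , _)) _                 = ¬GR GR
        conflict (inj₂ _)         (inj₁ (¬GR , _))  = ¬GR GR
        conflict (inj₂ (_ , _ , inj₁ (_ , intᵢ)))     (inj₂ (_ , _ , inj₁ (_ , intⱼ)))     =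
          interiors-disjoint i j i≢j _ (intᵢ , intⱼ)
        conflict (inj₂ (_ , _ , inj₁ (e∈S , _)))      (inj₂ (_ , _ , inj₂ (e∉S , _)))      = e∉S e∈S
        conflict (inj₂ (_ , _ , inj₂ (e∉S , _)))      (inj₂ (_ , _ , inj₁ (e∈S , _)))      = e∉S e∈S
        conflict (inj₂ (_ , rep∈Tᵢ , inj₂ (_ , ¬intᵢ))) (inj₂ (_ , rep∈Tⱼ , inj₂ (_ , ¬intⱼ))) =
          interiors-disjoint i j i≢j _
            (unchosen⇒second-end-Interior i rep∈Tᵢ ¬intᵢ , unchosen⇒second-end-Interior j rep∈Tⱼ ¬intⱼ)

      IDST⇒CIST : Σ (Fin k → Subgraph G) λ T′ →
        (∀ i → IsTree G (T′ i)) × (∀ i → RParallel G R (T i) (T′ i)) × IsCIST G R k T′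
      IDST⇒CIST = T′ , proj₁ ∘ T′-steiner , T′-parallel , T′-steiner ,
        λ u v u∈R v∈R _ i j i≢j P Q →
          edges-disjoint u∈R v∈R i j i≢j P Q , internal-vertices-disjoint i j i≢j P Q

proposition3p10 : {n m : ℕ} (G : Graph n m) → Connected G →
    (R : Subset n) → 3 ≤ ∣ R ∣ → TerminalsDoubled G R →
    (S : Subset m) → IsUnderlyingSimple G S → (k : ℕ) →
    ((T : Fin k → Subgraph G) → IsIDST G S R k T →
       Σ (Fin k → Subgraph G) (λ T′ → (∀ i → IsTree G (T′ i))
         × (∀ i → RParallel G R (T i) (T′ i)) × IsCIST G R k T′))
    × ((T′ : Fin k → Subgraph G) → IsCIST G R k T′ →
       (T : Fin k → Subgraph G) → (∀ i → IsTreeOfSimple G S (T i)) →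
       (∀ i → RParallel G R (T i) (T′ i)) → IsIDST G S R k T)
proposition3p10 G _ R 3≤∣R∣ doubled S simple k =
  (λ T idst → IDST⇒CIST G 3≤∣R∣ doubled simple idst) ,
  (λ T′ cist T trees par → CIST⇒IDST G (≤-trans (n≤1+n 2) 3≤∣R∣) cist trees par)
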